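{- Let \(G\) be a finite simple connected graph with \(\Delta(G)\leq 4\), not isomorphic to \(O_3\). Then: (1) If \(T\) is an internal triangle of \(G\) that does not share an edge with another internal triangle, then \(T\), as a vertex of \(K(G)\), is dominated in \(K(G)\) by one of the ears of \(Q_T\). (2) If \(T_{1}\) is an internal triangle sharing an edge with an internal triangle \(T_{2}\neq T_{1}\), then \(T_{1},T_{2}\) are twin vertices in \(K(G)\).
   Context: A clique is a maximal complete subgraph; \(K(G)\) is the intersection graph of the cliques of \(G\). A triangle \(T\) is internal if it is a clique and every edge of \(T\) is contained in a clique different from \(T\). For an internal triangle \(T\), \(Q_{T}=\{q\in K(G)\mid |q\cap T|\geq 2\}\), and the elements of \(Q_T\) other than \(T\) are its ears. A vertex \(u\) is dominated by \(v\) if \(N[u]\subseteq N[v]\); \(u,v\) are twins if \(N[u]=N[v]\) (closed neighborhoods). \(O_3\) is the complement of the disjoint union of three edges. -}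

module Defs where

open import Data.Nat using (ℕ; _≤_; _<_; _/_; _≟_)
open import Data.Empty using (⊥-elim)
open import Relation.Nullary using (yes; no)
open import Relation.Nullary.Decidable using (⌊_⌋)
open import Data.Bool using (Bool; true; false; not)
open import Data.Fin using (Fin; toℕ)
open import Data.Fin.Subset using (Subset; _∈_; _∉_; _⊆_; _∩_; ∣_∣)
open import Data.Vec using (tabulate)
open import Data.Product using (Σ; _×_; _,_; ∃)
open import Relation.Nullary using (¬_)
open import Relation.Binary.PropositionalEquality using (_≡_; _≢_; refl) renaming (sym to ≡-sym)
open import Function.Bundles using (_⤖_; Bijection)

record Graph (n : ℕ) : Set where
  field
    adj   : Fin n → Fin n → Bool
    irref : ∀ i → adj i i ≡ false
    sym   : ∀ i j → adj i j ≡ adj j i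
open Graph public

Adj : ∀ {n} → Graph n → Fin n → Fin n → Set
Adj G i j = adj G i j ≡ true

Nbhd : ∀ {n} → Graph n → Fin n → Subset n
Nbhd G v = tabulate (adj G v)

MaxDegreeAtMost : ∀ {n} → Graph n → ℕ → Set
MaxDegreeAtMost G k = ∀ v → ∣ Nbhd G v ∣ ≤ k

data Reach {n} (G : Graph n) : Fin n → Fin n → Set where
  here : ∀ {v} → Reach G v v
  step : ∀ {u v w} → Adj G u v → Reach G v w → Reach G u w

Connected : ∀ {n} → Graph n → Set
Connected G = ∀ u v → Reach G u v

Isomorphic : ∀ {n m} → Graph n → Graph m → Set
Isomorphic {n} {m} G H =
  Σ (Fin n ⤖ Fin m) λ f →
    ∀ i j → adj H (Bijection.to f i) (Bijection.to f j) ≡ adj G i j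

-- O₃ : complement of the disjoint union of three edges {0,1},{2,3},{4,5}
-- (vertices i, j adjacent iff they lie in different pairs, i.e. ⌊i/2⌋ ≠ ⌊j/2⌋)
o3adj : Fin 6 → Fin 6 → Bool
o3adj i j = not ⌊ toℕ i / 2 ≟ toℕ j / 2 ⌋

O3 : Graph 6
O3 = record { adj = o3adj ; irref = irr ; sym = sy }
  where
  irr : ∀ i → o3adj i i ≡ false
  irr i with toℕ i / 2 ≟ toℕ i / 2
  ... | yes _ = refl
  ... | no p = ⊥-elim (p refl)
  sy : ∀ i j → o3adj i j ≡ o3adj j i
  sy i j with toℕ i / 2 ≟ toℕ j / 2 | toℕ j / 2 ≟ toℕ i / 2
  ... | yes _ | yes _ = refl
  ... | no  _ | no  _ = refl
  ... | yes p | no q = ⊥-elim (q (≡-sym p))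
  ... | no p | yes q = ⊥-elim (p (≡-sym q))

Complete : ∀ {n} → Graph n → Subset n → Set
Complete G S = ∀ i j → i ∈ S → j ∈ S → i ≢ j → Adj G i j

IsClique : ∀ {n} → Graph n → Subset n → Set
IsClique G S = Complete G S × (∀ S′ → Complete G S′ → S ⊆ S′ → S′ ⊆ S)

Meets : ∀ {n} → Subset n → Subset n → Set
Meets p q = ∃ λ v → v ∈ p × v ∈ q

-- In the clique graph K(G), the closed neighbourhood of a clique q is the
-- set of cliques meeting q. Domination in K(G): N[p] ⊆ N[q].
DominatedInK : ∀ {n} → Graph n → Subset n → Subset n → Set
DominatedInK G p q = ∀ r → IsClique G r → Meets p r → Meets q r

TwinsInK : ∀ {n} → Graph n → Subset n → Subset n → Set
TwinsInK G p q = DominatedInK G p q × DominatedInK G q p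

IsTriangleClique : ∀ {n} → Graph n → Subset n → Set
IsTriangleClique G T = IsClique G T × ∣ T ∣ ≡ 3

IsInternalTriangle : ∀ {n} → Graph n → Subset n → Set
IsInternalTriangle G T =
  IsTriangleClique G T ×
  (∀ x y → x ∈ T → y ∈ T → x ≢ y →
     ∃ λ q → IsClique G q × q ≢ T × x ∈ q × y ∈ q)

IsEar : ∀ {n} → Graph n → Subset n → Subset n → Set
IsEar G T q = IsClique G q × q ≢ T × 2 ≤ ∣ q ∩ T ∣

ShareEdge : ∀ {n} → Subset n → Subset n → Set
ShareEdge T T′ = 2 ≤ ∣ T ∩ T′ ∣

module Submission where

-- An internal triangle T = {a, b, c} has on each edge an ear, whose apex lies outside T and
-- misses the opposite vertex; with Δ ≤ 4 these apexes exhaust the neighbourhoods of the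
-- triangle's vertices. If the apexes are pairwise adjacent (part 1), or if the apexes x, y over
-- the third vertices c, d of two triangles on a common edge ab are adjacent (part 2), six of
-- these vertices induce O₃; as O₃ is 4-regular, Δ ≤ 4 and connectivity then force G ≅ O₃.
-- Otherwise some vertex c has N(c) = {a, b, u, w} with u ≁ w, and every clique through c
-- contains a or b, hence meets each clique on the edge ab: the ear on ab dominates T, and two
-- triangles on ab are twins.

open import Defs hiding (sym)
open import Data.Nat using (ℕ; suc; _+_; _≤_; _<_; _≤?_; z≤n; s≤s)
open import Data.Nat.Properties using (≤-refl; ≤-trans; <-≤-trans; ≤-reflexive; +-suc; +-monoʳ-≤; <⇒≱)
open import Data.Bool using (true; false) renaming (_≟_ to _≟ᵇ_)
open import Data.Bool.Properties using (¬-not)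
open import Data.Fin using (Fin; zero) renaming (_≟_ to _≟ᶠ_)
open import Data.Fin.Patterns using (0F; 1F; 2F; 3F; 4F; 5F)
open import Data.Fin.Properties using (any?; all?)
open import Data.Fin.Subset using (Subset; inside; outside; _∈_; _∉_; _⊆_; _∪_; _-_; ⁅_⁆; ⊥; ∣_∣)
open import Data.Fin.Subset.Properties
  using (_∈?_; p⊆q⇒∣p∣≤∣q∣; ∣p∣≤∣x∷p∣; ∣⊥∣≡0; ∣⁅x⁆∣≡1; x∈p⇒∣p-x∣<∣p∣; x∈p∧x≢y⇒x∈p-y; x∈⁅x⁆;
         x∉⁅y⁆⇒x≢y; x∈⁅y⁆⇒x≡y; x∈p∪q⁺; x∈p∪q⁻; p⊆p∪q; x∈p∩q⁺; x∈p∩q⁻; ⊆-antisym)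
open import Data.Vec using ([]; _∷_; tabulate)
open import Data.Vec.Properties using (lookup∘tabulate; lookup⇒[]=)
open import Data.List using (List; []; _∷_; length; filter; allFin)
open import Data.List.Properties using (length-map)
open import Data.List.Relation.Unary.All using (All; []; _∷_)
import Data.List.Relation.Unary.All as All
open import Data.List.Relation.Unary.All.Properties using (¬Any⇒All¬; all-filter)
import Data.List.Relation.Unary.All.Properties as All
open import Data.List.Relation.Unary.Any using (here; there)
import Data.List.Relation.Unary.Any as Any
open import Data.List.Relation.Unary.AllPairs using ([]; _∷_)
open import Data.List.Relation.Unary.Unique.Propositional using (Unique)
open import Data.List.Relation.Unary.Unique.Propositional.Properties using (allFin⁺; filter⁺)
import Data.List.Relation.Unary.Unique.Propositional.Properties as Unique
open import Data.List.Membership.Propositional using () renaming (_∈_ to _∈ₗ_)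
open import Data.List.Membership.Propositional.Properties using (∈-map⁻)
open import Data.Product using (_×_; ∃; ∃₂; _,_; proj₁; proj₂)
import Data.Product as Product
open import Data.Sum using (_⊎_; inj₁; inj₂; [_,_])
import Data.Sum as Sum
open import Data.Empty using (⊥-elim)
open import Function using (_∘_; id)
open import Function.Bundles using (mk↔ₛ′)
open import Function.Properties.Inverse using (↔⇒⤖)
open import Relation.Nullary using (¬_; Dec; yes; no; ¬?; _×-dec_; _⊎-dec_; _→-dec_)
open import Relation.Nullary.Decidable using (from-yes)
open import Relation.Binary.PropositionalEquality
  using (_≡_; _≢_; refl; sym; trans; cong; cong₂; subst; ≢-sym; module ≡-Reasoning)

private
  variable
    n m : ℕ
    a b c x : Fin n
    p q T T′ : Subset n
    xs : List (Fin n)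

∣p∪q∣≤∣p∣+∣q∣ : (p q : Subset n) → ∣ p ∪ q ∣ ≤ ∣ p ∣ + ∣ q ∣
∣p∪q∣≤∣p∣+∣q∣ []            []            = z≤n
∣p∪q∣≤∣p∣+∣q∣ (inside  ∷ p) (s ∷ q)       =
  s≤s (≤-trans (∣p∪q∣≤∣p∣+∣q∣ p q) (+-monoʳ-≤ ∣ p ∣ (∣p∣≤∣x∷p∣ s q)))
∣p∪q∣≤∣p∣+∣q∣ (outside ∷ p) (inside  ∷ q) =
  subst (suc ∣ p ∪ q ∣ ≤_) (sym (+-suc ∣ p ∣ ∣ q ∣)) (s≤s (∣p∪q∣≤∣p∣+∣q∣ p q))
∣p∪q∣≤∣p∣+∣q∣ (outside ∷ p) (outside ∷ q) = ∣p∪q∣≤∣p∣+∣q∣ p q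

∈∧∉⇒≢ : x ∈ p → a ∉ p → x ≢ a
∈∧∉⇒≢ x∈p x∉p refl = x∉p x∈p

p⊈q⇒∃∈p∖q : ¬ p ⊆ q → ∃ λ x → x ∈ p × x ∉ q
p⊈q⇒∃∈p∖q {p = p} {q = q} p⊈q with any? (λ x → x ∈? p ×-dec ¬? (x ∈? q))
... | yes found = found
... | no none   = ⊥-elim (p⊈q p⊆q)
  where
  p⊆q : p ⊆ q
  p⊆q {x} x∈p with x ∈? q
  ... | yes x∈q = x∈q
  ... | no  x∉q = ⊥-elim (none (x , x∈p , x∉q))

∣q∣<∣p∣⇒∃∈p∖q : ∣ q ∣ < ∣ p ∣ → ∃ λ x → x ∈ p × x ∉ q
∣q∣<∣p∣⇒∃∈p∖q ∣q∣<∣p∣ = p⊈q⇒∃∈p∖q (<⇒≱ ∣q∣<∣p∣ ∘ p⊆q⇒∣p∣≤∣q∣)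

unique⊆⇒length≤∣p∣ : Unique xs → All (_∈ p) xs → length xs ≤ ∣ p ∣
unique⊆⇒length≤∣p∣ []               []            = z≤n
unique⊆⇒length≤∣p∣ {xs = x ∷ _} {p = p} (x≢xs ∷ xs-uniq) (x∈p ∷ xs⊆p) =
  <-≤-trans (s≤s (unique⊆⇒length≤∣p∣ xs-uniq (All.zipWith ∈p-x (x≢xs , xs⊆p)))) (x∈p⇒∣p-x∣<∣p∣ x∈p)
  where
  ∈p-x : ∀ {y} → x ≢ y × y ∈ p → y ∈ p - x
  ∈p-x (x≢y , y∈p) = x∈p∧x≢y⇒x∈p-y y∈p (≢-sym x≢y)

unique⊆∧∣p∣≤length⇒listed : Unique xs → All (_∈ p) xs → ∣ p ∣ ≤ length xs → x ∈ p → x ∈ₗ xs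
unique⊆∧∣p∣≤length⇒listed {xs = xs} {x = x} xs-uniq xs⊆p ∣p∣≤len x∈p with Any.any? (x ≟ᶠ_) xs
... | yes x∈xs = x∈xs
... | no  x∉xs =
  ⊥-elim (<⇒≱ (unique⊆⇒length≤∣p∣ (¬Any⇒All¬ xs x∉xs ∷ xs-uniq) (x∈p ∷ xs⊆p)) ∣p∣≤len)

2≤∣p∣⇒∃-distinct-pair : 2 ≤ ∣ p ∣ → ∃₂ λ a b → a ∈ p × b ∈ p × a ≢ b
2≤∣p∣⇒∃-distinct-pair {n} {p} 2≤∣p∣
  with ∣q∣<∣p∣⇒∃∈p∖q {q = ⊥} (subst (_< ∣ p ∣) (sym (∣⊥∣≡0 n)) (≤-trans (s≤s z≤n) 2≤∣p∣))
... | a , a∈p , _ with ∣q∣<∣p∣⇒∃∈p∖q {q = ⁅ a ⁆} (subst (_< ∣ p ∣) (sym (∣⁅x⁆∣≡1 a)) 2≤∣p∣)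
...   | b , b∈p , b∉⁅a⁆ = a , b , a∈p , b∈p , ≢-sym (x∉⁅y⁆⇒x≢y b∉⁅a⁆)

record Triple (T : Subset n) (a b c : Fin n) : Set where
  field
    a∈  : a ∈ T
    b∈  : b ∈ T
    c∈  : c ∈ T
    a≢b : a ≢ b
    a≢c : a ≢ c
    b≢c : b ≢ c
    only : x ∈ T → x ∈ₗ a ∷ b ∷ c ∷ []
open Triple

rotate : Triple T a b c → Triple T b c a
rotate t = record
  { a∈ = b∈ t ; b∈ = c∈ t ; c∈ = a∈ t ; a≢b = b≢c t ; a≢c = ≢-sym (a≢b t) ; b≢c = ≢-sym (a≢c t)
  ; only = rot ∘ only t }
  where
  rot : x ∈ₗ a ∷ b ∷ c ∷ [] → x ∈ₗ b ∷ c ∷ a ∷ []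
  rot (here x≡a)                 = there (there (here x≡a))
  rot (there (here x≡b))         = here x≡b
  rot (there (there (here x≡c))) = there (here x≡c)

swap : Triple T a b c → Triple T b a c
swap t = record
  { a∈ = b∈ t ; b∈ = a∈ t ; c∈ = c∈ t ; a≢b = ≢-sym (a≢b t) ; a≢c = b≢c t ; b≢c = a≢c t
  ; only = swp ∘ only t }
  where
  swp : x ∈ₗ a ∷ b ∷ c ∷ [] → x ∈ₗ b ∷ a ∷ c ∷ []
  swp (here x≡a)                 = there (here x≡a)
  swp (there (here x≡b))         = here x≡b
  swp (there (there (here x≡c))) = there (there (here x≡c))

Triple⇒⊆ : Triple T a b c → a ∈ T′ → b ∈ T′ → c ∈ T′ → T ⊆ T′
Triple⇒⊆ t a∈T′ b∈T′ c∈T′ x∈T with only t x∈T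
... | here refl                 = a∈T′
... | there (here refl)         = b∈T′
... | there (there (here refl)) = c∈T′

Triple-unique : Triple T a b c → Triple T′ a b c → T ≡ T′
Triple-unique t t′ = ⊆-antisym (Triple⇒⊆ t (a∈ t′) (b∈ t′) (c∈ t′)) (Triple⇒⊆ t′ (a∈ t) (b∈ t) (c∈ t))

∣T∣≡3⇒Triple : ∣ T ∣ ≡ 3 → a ∈ T → b ∈ T → a ≢ b → ∃ λ c → Triple T a b c
∣T∣≡3⇒Triple {T = T} {a = a} {b = b} ∣T∣≡3 a∈T b∈T a≢b
  with ∣q∣<∣p∣⇒∃∈p∖q {q = ⁅ a ⁆ ∪ ⁅ b ⁆} (subst (_ <_) (sym ∣T∣≡3) ∣⁅a⁆∪⁅b⁆∣<3)
  where
  ∣⁅a⁆∪⁅b⁆∣<3 : ∣ ⁅ a ⁆ ∪ ⁅ b ⁆ ∣ < 3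
  ∣⁅a⁆∪⁅b⁆∣<3 =
    s≤s (subst (∣ ⁅ a ⁆ ∪ ⁅ b ⁆ ∣ ≤_) (cong₂ _+_ (∣⁅x⁆∣≡1 a) (∣⁅x⁆∣≡1 b)) (∣p∪q∣≤∣p∣+∣q∣ ⁅ a ⁆ ⁅ b ⁆))
... | c , c∈T , c∉⁅a⁆∪⁅b⁆ = c , record
  { a∈ = a∈T ; b∈ = b∈T ; c∈ = c∈T ; a≢b = a≢b ; a≢c = ≢-sym c≢a ; b≢c = ≢-sym c≢b
  ; only = unique⊆∧∣p∣≤length⇒listed ((a≢b ∷ ≢-sym c≢a ∷ []) ∷ (≢-sym c≢b ∷ []) ∷ [] ∷ [])
                                     (a∈T ∷ b∈T ∷ c∈T ∷ []) (≤-reflexive ∣T∣≡3) }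
  where
  c≢a : c ≢ a
  c≢a = x∉⁅y⁆⇒x≢y (c∉⁅a⁆∪⁅b⁆ ∘ x∈p∪q⁺ ∘ inj₁)
  c≢b : c ≢ b
  c≢b = x∉⁅y⁆⇒x≢y (c∉⁅a⁆∪⁅b⁆ ∘ x∈p∪q⁺ ∘ inj₂)

module _ (G : Graph n) where

  private
    variable
      u v w : Fin n
      r : Subset n

  Adj-sym : Adj G u v → Adj G v u
  Adj-sym {u} {v} u~v = trans (Graph.sym G v u) u~v

  Adj⇒≢ : Adj G u v → u ≢ v
  Adj⇒≢ {u} u~u refl with trans (sym u~u) (irref G u)
  ... | ()

  Adj? : ∀ u v → Dec (Adj G u v)
  Adj? u v = adj G u v ≟ᵇ true

  Adj⇒∈Nbhd : Adj G v u → u ∈ Nbhd G v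
  Adj⇒∈Nbhd {v} {u} v~u = lookup⇒[]= u (tabulate (adj G v)) (trans (lookup∘tabulate (adj G v) u) v~u)

  maxDegree⇒listed : ∀ {Δ} → MaxDegreeAtMost G Δ → Unique xs → All (Adj G v) xs → Δ ≤ length xs →
                     Adj G v u → u ∈ₗ xs
  maxDegree⇒listed {v = v} maxDeg xs-uniq v~xs Δ≤len v~u =
    unique⊆∧∣p∣≤length⇒listed xs-uniq (All.map Adj⇒∈Nbhd v~xs) (≤-trans (maxDeg v) Δ≤len) (Adj⇒∈Nbhd v~u)

  clique-maximal : IsClique G r → (∀ {y} → y ∈ r → y ≢ v → Adj G v y) → v ∈ r
  clique-maximal {r} {v} (r-complete , r-maximal) v~r =
    r-maximal (r ∪ ⁅ v ⁆) r∪v-complete (p⊆p∪q ⁅ v ⁆) (x∈p∪q⁺ (inj₂ (x∈⁅x⁆ v)))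
    where
    ∈r∪v : ∀ {i} → i ∈ r ∪ ⁅ v ⁆ → i ∈ r ⊎ i ≡ v
    ∈r∪v = Sum.map₂ (x∈⁅y⁆⇒x≡y v) ∘ x∈p∪q⁻ r ⁅ v ⁆
    r∪v-complete : Complete G (r ∪ ⁅ v ⁆)
    r∪v-complete i j i∈ j∈ i≢j with ∈r∪v i∈ | ∈r∪v j∈
    ... | inj₁ i∈r | inj₁ j∈r = r-complete i j i∈r j∈r i≢j
    ... | inj₁ i∈r | inj₂ refl = Adj-sym (v~r i∈r i≢j)
    ... | inj₂ refl | inj₁ j∈r = v~r j∈r (≢-sym i≢j)
    ... | inj₂ refl | inj₂ refl = ⊥-elim (i≢j refl)

  clique-member⇒≡⊎Adj : IsClique G r → u ∈ r → v ∈ r → v ≡ u ⊎ Adj G u v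
  clique-member⇒≡⊎Adj {u = u} {v = v} (r-complete , _) u∈r v∈r with v ≟ᶠ u
  ... | yes v≡u = inj₁ v≡u
  ... | no  v≢u = inj₂ (r-complete u v u∈r v∈r (≢-sym v≢u))

  distinct-cliques⇒∃∈∖ : IsClique G q → IsClique G T → q ≢ T → ∃ λ x → x ∈ q × x ∉ T
  distinct-cliques⇒∃∈∖ (_ , q-maximal) (T-complete , _) q≢T =
    p⊈q⇒∃∈p∖q λ q⊆T → q≢T (⊆-antisym q⊆T (q-maximal _ T-complete q⊆T))

  module TriangleEdges {T a b c} (T-complete : Complete G T) (t : Triple T a b c) where
    a~b : Adj G a b
    a~b = T-complete a b (a∈ t) (b∈ t) (a≢b t)
    a~c : Adj G a c
    a~c = T-complete a c (a∈ t) (c∈ t) (a≢c t)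
    b~c : Adj G b c
    b~c = T-complete b c (b∈ t) (c∈ t) (b≢c t)

  adjacent-to-Triple⇒∈ : IsClique G T → Triple T a b c → Adj G x a → Adj G x b → Adj G x c → x ∈ T
  adjacent-to-Triple⇒∈ {T = T} {x = x} T-clique t x~a x~b x~c = clique-maximal T-clique x~T
    where
    x~T : ∀ {y} → y ∈ T → y ≢ x → Adj G x y
    x~T y∈T _ with only t y∈T
    ... | here refl                 = x~a
    ... | there (here refl)         = x~b
    ... | there (there (here refl)) = x~c

MinDegreeAtLeast : Graph m → ℕ → Set
MinDegreeAtLeast H Δ = ∀ k → ∃ λ xs → Unique xs × All (Adj H k) xs × Δ ≤ length xs

record InducedEmbedding (H : Graph m) (G : Graph n) : Set where
  field
    vertex    : Fin m → Fin n
    injective : ∀ {k l} → vertex k ≡ vertex l → k ≡ l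
    adj-≡     : ∀ k l → adj G (vertex k) (vertex l) ≡ adj H k l

module _ {G : Graph n} {H : Graph (suc m)} where

  -- Each embedded vertex already has Δ embedded neighbours, so by the degree bound all its
  -- neighbours are embedded; connectivity spreads this to every vertex of G.
  minDegree-embedding⇒iso : ∀ {Δ} → Connected G → MaxDegreeAtMost G Δ → MinDegreeAtLeast H Δ →
                            InducedEmbedding H G → Isomorphic G H
  minDegree-embedding⇒iso {Δ} connected maxDeg minDeg emb =
    ↔⇒⤖ (mk↔ₛ′ preimage vertex preimage∘vertex vertex∘preimage) , adj-preimage
    where
    open InducedEmbedding emb

    neighbour-embedded : ∀ k {y} → Adj G (vertex k) y → ∃ λ l → y ≡ vertex l
    neighbour-embedded k k~y with minDeg k
    ... | ls , ls-uniq , k~ls , Δ≤len = Product.map₂ proj₂ (∈-map⁻ vertex (maxDegree⇒listed G maxDeg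
      (Unique.map⁺ injective ls-uniq)
      (All.map⁺ (All.map (λ {l} k~l → trans (adj-≡ k l) k~l) k~ls))
      (subst (Δ ≤_) (sym (length-map vertex ls)) Δ≤len)
      k~y))

    reach-embedded : ∀ {x y} → Reach G x y → ∃ (λ k → x ≡ vertex k) → ∃ λ l → y ≡ vertex l
    reach-embedded here           x-embedded = x-embedded
    reach-embedded (step x~z z⇝y) (k , refl) = reach-embedded z⇝y (neighbour-embedded k x~z)

    embedded : ∀ y → ∃ λ l → y ≡ vertex l
    embedded y = reach-embedded (connected (vertex zero) y) (zero , refl)

    preimage : Fin n → Fin (suc m)
    preimage y = proj₁ (embedded y)

    vertex∘preimage : ∀ y → vertex (preimage y) ≡ y
    vertex∘preimage y = sym (proj₂ (embedded y))

    preimage∘vertex : ∀ k → preimage (vertex k) ≡ k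
    preimage∘vertex k = injective (vertex∘preimage (vertex k))

    adj-preimage : ∀ i j → adj H (preimage i) (preimage j) ≡ adj G i j
    adj-preimage i j = begin
      adj H (preimage i) (preimage j)                   ≡⟨ sym (adj-≡ (preimage i) (preimage j)) ⟩
      adj G (vertex (preimage i)) (vertex (preimage j)) ≡⟨ cong₂ (adj G) (vertex∘preimage i) (vertex∘preimage j) ⟩
      adj G i j                                         ∎
      where open ≡-Reasoning

O3-adj? : ∀ k l → Dec (Adj O3 k l)
O3-adj? k l = o3adj k l ≟ᵇ true

O3-neighbours : Fin 6 → List (Fin 6)
O3-neighbours k = filter (O3-adj? k) (allFin 6)

O3-minDegree : MinDegreeAtLeast O3 4
O3-minDegree k =
  O3-neighbours k , filter⁺ (O3-adj? k) (allFin⁺ 6) , all-filter (O3-adj? k) (allFin 6) , 4≤degree k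
  where
  4≤degree : ∀ k → 4 ≤ length (O3-neighbours k)
  4≤degree = from-yes (all? λ k → 4 ≤? length (O3-neighbours k))

mate : Fin 6 → Fin 6
mate 0F = 1F
mate 1F = 0F
mate 2F = 3F
mate 3F = 2F
mate 4F = 5F
mate 5F = 4F

O3-nonadjacent : ∀ k l → o3adj k l ≡ false → k ≡ l ⊎ l ≡ mate k
O3-nonadjacent = from-yes (all? λ k → all? λ l → (o3adj k l ≟ᵇ false) →-dec (k ≟ᶠ l ⊎-dec l ≟ᶠ mate k))

module _ (G : Graph n) where

  private
    variable
      d : Fin n
      r T₁ T₂ : Subset n

  -- {v₀,v₁}, {v₂,v₃}, {v₄,v₅} play the non-edges {0,1}, {2,3}, {4,5} of O₃.
  O3-embedding : ∀ {v₀ v₁ v₂ v₃ v₄ v₅} →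
    v₀ ≢ v₁ → v₂ ≢ v₃ → v₄ ≢ v₅ → ¬ Adj G v₀ v₁ → ¬ Adj G v₂ v₃ → ¬ Adj G v₄ v₅ →
    Adj G v₀ v₂ → Adj G v₀ v₃ → Adj G v₀ v₄ → Adj G v₀ v₅ →
    Adj G v₁ v₂ → Adj G v₁ v₃ → Adj G v₁ v₄ → Adj G v₁ v₅ →
    Adj G v₂ v₄ → Adj G v₂ v₅ → Adj G v₃ v₄ → Adj G v₃ v₅ → InducedEmbedding O3 G
  O3-embedding {v₀} {v₁} {v₂} {v₃} {v₄} {v₅} d01 d23 d45 n01 n23 n45
               e02 e03 e04 e05 e12 e13 e14 e15 e24 e25 e34 e35 =
    record { vertex = vertex ; injective = injective ; adj-≡ = adj-≡ }
    where
    vertex : Fin 6 → Fin n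
    vertex 0F = v₀
    vertex 1F = v₁
    vertex 2F = v₂
    vertex 3F = v₃
    vertex 4F = v₄
    vertex 5F = v₅

    adj-≡ : ∀ k l → adj G (vertex k) (vertex l) ≡ o3adj k l
    adj-≡ 0F 0F = irref G v₀
    adj-≡ 0F 1F = ¬-not n01
    adj-≡ 0F 2F = e02
    adj-≡ 0F 3F = e03
    adj-≡ 0F 4F = e04
    adj-≡ 0F 5F = e05
    adj-≡ 1F 0F = ¬-not (n01 ∘ Adj-sym G)
    adj-≡ 1F 1F = irref G v₁
    adj-≡ 1F 2F = e12
    adj-≡ 1F 3F = e13
    adj-≡ 1F 4F = e14
    adj-≡ 1F 5F = e15
    adj-≡ 2F 0F = Adj-sym G e02
    adj-≡ 2F 1F = Adj-sym G e12
    adj-≡ 2F 2F = irref G v₂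
    adj-≡ 2F 3F = ¬-not n23
    adj-≡ 2F 4F = e24
    adj-≡ 2F 5F = e25
    adj-≡ 3F 0F = Adj-sym G e03
    adj-≡ 3F 1F = Adj-sym G e13
    adj-≡ 3F 2F = ¬-not (n23 ∘ Adj-sym G)
    adj-≡ 3F 3F = irref G v₃
    adj-≡ 3F 4F = e34
    adj-≡ 3F 5F = e35
    adj-≡ 4F 0F = Adj-sym G e04
    adj-≡ 4F 1F = Adj-sym G e14
    adj-≡ 4F 2F = Adj-sym G e24
    adj-≡ 4F 3F = Adj-sym G e34
    adj-≡ 4F 4F = irref G v₄
    adj-≡ 4F 5F = ¬-not n45
    adj-≡ 5F 0F = Adj-sym G e05
    adj-≡ 5F 1F = Adj-sym G e15
    adj-≡ 5F 2F = Adj-sym G e25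
    adj-≡ 5F 3F = Adj-sym G e35
    adj-≡ 5F 4F = ¬-not (n45 ∘ Adj-sym G)
    adj-≡ 5F 5F = irref G v₅

    vertex≢mate : ∀ k → vertex k ≢ vertex (mate k)
    vertex≢mate 0F = d01
    vertex≢mate 1F = ≢-sym d01
    vertex≢mate 2F = d23
    vertex≢mate 3F = ≢-sym d23
    vertex≢mate 4F = d45
    vertex≢mate 5F = ≢-sym d45

    injective : ∀ {k l} → vertex k ≡ vertex l → k ≡ l
    injective {k} {l} vk≡vl with O3-nonadjacent k l (begin
        o3adj k l                   ≡⟨ sym (adj-≡ k l) ⟩
        adj G (vertex k) (vertex l) ≡⟨ cong (adj G (vertex k)) (sym vk≡vl) ⟩
        adj G (vertex k) (vertex k) ≡⟨ irref G (vertex k) ⟩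
        false                       ∎)
      where open ≡-Reasoning
    ... | inj₁ k≡l  = k≡l
    ... | inj₂ refl = ⊥-elim (vertex≢mate k vk≡vl)

  record Ear (T : Subset n) (a b c : Fin n) : Set where
    field
      clique        : Subset n
      isClique      : IsClique G clique
      clique≢T      : clique ≢ T
      left∈         : a ∈ clique
      right∈        : b ∈ clique
      apex          : Fin n
      apex∉T        : apex ∉ T
      left~apex     : Adj G a apex
      right~apex    : Adj G b apex
      apex≁opposite : ¬ Adj G apex c
  open Ear

  ear : IsInternalTriangle G T → Triple T a b c → Ear T a b c
  ear {a = a} {b = b} ((T-clique , _) , edges-in-other-cliques) t
    with edges-in-other-cliques a b (a∈ t) (b∈ t) (a≢b t)
  ... | q , q-clique , q≢T , a∈q , b∈q with distinct-cliques⇒∃∈∖ G q-clique T-clique q≢T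
  ...   | z , z∈q , z∉T = record
    { clique = q ; isClique = q-clique ; clique≢T = q≢T ; left∈ = a∈q ; right∈ = b∈q
    ; apex = z ; apex∉T = z∉T ; left~apex = a~z ; right~apex = b~z
    ; apex≁opposite = λ z~c → z∉T (adjacent-to-Triple⇒∈ G T-clique t (Adj-sym G a~z) (Adj-sym G b~z) z~c) }
    where
    a~z : Adj G a z
    a~z = proj₁ q-clique a z a∈q z∈q (∈∧∉⇒≢ (a∈ t) z∉T)
    b~z : Adj G b z
    b~z = proj₁ q-clique b z b∈q z∈q (∈∧∉⇒≢ (b∈ t) z∉T)

  Ear⇒IsEar : Triple T a b c → (E : Ear T a b c) → IsEar G T (clique E)
  Ear⇒IsEar t E = isClique E , clique≢T E ,
    unique⊆⇒length≤∣p∣ ((a≢b t ∷ []) ∷ [] ∷ []) (x∈p∩q⁺ (left∈ E , a∈ t) ∷ x∈p∩q⁺ (right∈ E , b∈ t) ∷ [])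

  Triple-dominated : Triple T a b c → a ∈ q → b ∈ q →
                     (∀ {r} → IsClique G r → c ∈ r → a ∈ r ⊎ b ∈ r) → DominatedInK G T q
  Triple-dominated {a = a} {b = b} t a∈q b∈q c-covered r r-clique (v , v∈T , v∈r) with only t v∈T
  ... | here refl                 = v , a∈q , v∈r
  ... | there (here refl)         = v , b∈q , v∈r
  ... | there (there (here refl)) =
    [ (λ a∈r → a , a∈q , a∈r) , (λ b∈r → b , b∈q , b∈r) ] (c-covered r-clique v∈r)

  -- r lies in N[c] = {c, a, b, u, w} and cannot hold both u and w; whichever of them it
  -- avoids, a or b sees all of r, so maximality puts that vertex in r.
  clique∋c⇒a∈⊎b∈ : ∀ {u w} → (∀ {y} → Adj G c y → y ∈ₗ a ∷ b ∷ u ∷ w ∷ []) → u ≢ w → ¬ Adj G u w →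
                   Adj G a b → Adj G a c → Adj G b c → Adj G a w → Adj G b u →
                   IsClique G r → c ∈ r → a ∈ r ⊎ b ∈ r
  clique∋c⇒a∈⊎b∈ {a = a} {b = b} {r = r} {w = w} N[c] u≢w u≁w a~b a~c b~c a~w b~u r-clique c∈r
    with w ∈? r
  ... | yes w∈r = inj₁ (clique-maximal G r-clique a~r)
    where
    a~r : ∀ {y} → y ∈ r → y ≢ a → Adj G a y
    a~r y∈r y≢a with clique-member⇒≡⊎Adj G r-clique c∈r y∈r
    ... | inj₁ refl = a~c
    ... | inj₂ c~y with N[c] c~y
    ...   | here refl                         = ⊥-elim (y≢a refl)
    ...   | there (here refl)                 = a~b
    ...   | there (there (here refl))         = ⊥-elim (u≁w (proj₁ r-clique _ _ y∈r w∈r u≢w))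
    ...   | there (there (there (here refl))) = a~w
  ... | no w∉r = inj₂ (clique-maximal G r-clique b~r)
    where
    b~r : ∀ {y} → y ∈ r → y ≢ b → Adj G b y
    b~r y∈r y≢b with clique-member⇒≡⊎Adj G r-clique c∈r y∈r
    ... | inj₁ refl = b~c
    ... | inj₂ c~y with N[c] c~y
    ...   | here refl                         = Adj-sym G a~b
    ...   | there (here refl)                 = ⊥-elim (y≢b refl)
    ...   | there (there (here refl))         = b~u
    ...   | there (there (there (here refl))) = ⊥-elim (w∉r y∈r)

  ears-span-O3 : Complete G T → Triple T a b c →
                 (E₁ : Ear T a b c) (E₂ : Ear T b c a) (E₃ : Ear T c a b) →
                 Adj G (apex E₂) (apex E₃) → Adj G (apex E₃) (apex E₁) → Adj G (apex E₁) (apex E₂) →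
                 InducedEmbedding O3 G
  ears-span-O3 T-complete t E₁ E₂ E₃ z₂~z₃ z₃~z₁ z₁~z₂ =
    O3-embedding (∈∧∉⇒≢ (a∈ t) (apex∉T E₂)) (∈∧∉⇒≢ (b∈ t) (apex∉T E₃)) (∈∧∉⇒≢ (c∈ t) (apex∉T E₁))
      (apex≁opposite E₂ ∘ Adj-sym G) (apex≁opposite E₃ ∘ Adj-sym G) (apex≁opposite E₁ ∘ Adj-sym G)
      a~b (right~apex E₃) a~c (left~apex E₁)
      (Adj-sym G (left~apex E₂)) z₂~z₃ (Adj-sym G (right~apex E₂)) (Adj-sym G z₁~z₂)
      b~c (right~apex E₁) (Adj-sym G (left~apex E₃)) z₃~z₁
    where open TriangleEdges G T-complete t

  third-vertices-distinct : T₂ ≢ T₁ → Triple T₁ a b c → Triple T₂ a b d → c ≢ d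
  third-vertices-distinct T₂≢T₁ t₁ t₂ refl = T₂≢T₁ (Triple-unique t₂ t₁)

  third-vertices-nonadjacent : IsClique G T₁ → Complete G T₂ → Triple T₁ a b c → Triple T₂ a b d →
                               c ≢ d → ¬ Adj G c d
  third-vertices-nonadjacent T₁-clique T₂-complete t₁ t₂ c≢d c~d
    with only t₁ (adjacent-to-Triple⇒∈ G T₁-clique t₁ (Adj-sym G a~c) (Adj-sym G b~c) (Adj-sym G c~d))
    where open TriangleEdges G T₂-complete t₂
  ... | here d≡a                 = a≢c t₂ (sym d≡a)
  ... | there (here d≡b)         = b≢c t₂ (sym d≡b)
  ... | there (there (here d≡c)) = c≢d (sym d≡c)

  module _ (maxDeg : MaxDegreeAtMost G 4) where

    ear-dominates : Complete G T → (t : Triple T a b c) →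
                    (E₁ : Ear T a b c) (E₂ : Ear T b c a) (E₃ : Ear T c a b) →
                    ¬ Adj G (apex E₂) (apex E₃) → DominatedInK G T (clique E₁)
    ear-dominates {a = a} {b = b} {c = c} T-complete t E₁ E₂ E₃ z₂≁z₃ =
      Triple-dominated t (left∈ E₁) (right∈ E₁)
        (clique∋c⇒a∈⊎b∈ N[c] z₂≢z₃ z₂≁z₃ a~b a~c b~c (right~apex E₃) (left~apex E₂))
      where
      open TriangleEdges G T-complete t
      z₂≢z₃ : apex E₂ ≢ apex E₃
      z₂≢z₃ z₂≡z₃ = apex≁opposite E₂ (subst (λ z → Adj G z a) (sym z₂≡z₃) (Adj-sym G (right~apex E₃)))
      N[c] : ∀ {y} → Adj G c y → y ∈ₗ a ∷ b ∷ apex E₂ ∷ apex E₃ ∷ []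
      N[c] = maxDegree⇒listed G maxDeg
        ((a≢b t ∷ ∈∧∉⇒≢ (a∈ t) (apex∉T E₂) ∷ Adj⇒≢ G (right~apex E₃) ∷ []) ∷
         (Adj⇒≢ G (left~apex E₂) ∷ ∈∧∉⇒≢ (b∈ t) (apex∉T E₃) ∷ []) ∷ (z₂≢z₃ ∷ []) ∷ [] ∷ [])
        (Adj-sym G a~c ∷ Adj-sym G b~c ∷ right~apex E₂ ∷ left~apex E₃ ∷ []) ≤-refl

    dominating-ear-or-O3 : Complete G T → Triple T a b c → Ear T a b c → Ear T b c a → Ear T c a b →
                           InducedEmbedding O3 G ⊎ ∃ λ q → IsEar G T q × DominatedInK G T q
    dominating-ear-or-O3 T-complete t E₁ E₂ E₃
      with Adj? G (apex E₂) (apex E₃) | Adj? G (apex E₃) (apex E₁) | Adj? G (apex E₁) (apex E₂)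
    ... | no z₂≁z₃ | _ | _ =
      inj₂ (clique E₁ , Ear⇒IsEar t E₁ , ear-dominates T-complete t E₁ E₂ E₃ z₂≁z₃)
    ... | yes _ | no z₃≁z₁ | _ =
      inj₂ (clique E₂ , Ear⇒IsEar t′ E₂ , ear-dominates T-complete t′ E₂ E₃ E₁ z₃≁z₁)
      where t′ = rotate t
    ... | yes _ | yes _ | no z₁≁z₂ =
      inj₂ (clique E₃ , Ear⇒IsEar t″ E₃ , ear-dominates T-complete t″ E₃ E₁ E₂ z₁≁z₂)
      where t″ = rotate (rotate t)
    ... | yes z₂~z₃ | yes z₃~z₁ | yes z₁~z₂ = inj₁ (ears-span-O3 T-complete t E₁ E₂ E₃ z₂~z₃ z₃~z₁ z₁~z₂)

    internal-triangle-dominated : IsInternalTriangle G T →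
                                  InducedEmbedding O3 G ⊎ ∃ λ q → IsEar G T q × DominatedInK G T q
    internal-triangle-dominated T-internal@(((T-complete , _) , ∣T∣≡3) , _)
      with 2≤∣p∣⇒∃-distinct-pair (subst (2 ≤_) (sym ∣T∣≡3) (s≤s (s≤s z≤n)))
    ... | a , b , a∈T , b∈T , a≢b with ∣T∣≡3⇒Triple ∣T∣≡3 a∈T b∈T a≢b
    ...   | c , t = dominating-ear-or-O3 T-complete t
                      (ear T-internal t) (ear T-internal (rotate t)) (ear T-internal (rotate (rotate t)))

    -- The apex of the ear of T₂ on ad is a neighbour of a, and N(a) = {b, c, d, apex E}.
    shared-apex : Complete G T₁ → Complete G T₂ → Triple T₁ a b c → Triple T₂ a b d → c ≢ d → ¬ Adj G c d →
                  (E : Ear T₁ a c b) (E′ : Ear T₂ a d b) → Adj G d (apex E)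
    shared-apex {a = a} {b = b} {c = c} {d = d} T₁-complete T₂-complete t₁ t₂ c≢d c≁d E E′ =
      from-N[a] (N[a] (left~apex E′))
      where
      open TriangleEdges G T₁-complete t₁
      open TriangleEdges G T₂-complete t₂ using () renaming (a~c to a~d)
      d≢x : d ≢ apex E
      d≢x d≡x = c≁d (subst (Adj G c) (sym d≡x) (right~apex E))
      N[a] : ∀ {y} → Adj G a y → y ∈ₗ b ∷ c ∷ d ∷ apex E ∷ []
      N[a] = maxDegree⇒listed G maxDeg
        ((b≢c t₁ ∷ b≢c t₂ ∷ ∈∧∉⇒≢ (b∈ t₁) (apex∉T E) ∷ []) ∷
         (c≢d ∷ Adj⇒≢ G (right~apex E) ∷ []) ∷ (d≢x ∷ []) ∷ [] ∷ [])
        (a~b ∷ a~c ∷ a~d ∷ left~apex E ∷ []) ≤-refl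
      from-N[a] : apex E′ ∈ₗ b ∷ c ∷ d ∷ apex E ∷ [] → Adj G d (apex E)
      from-N[a] (here refl)                         = ⊥-elim (apex∉T E′ (b∈ t₂))
      from-N[a] (there (here refl))                 = ⊥-elim (c≁d (Adj-sym G (right~apex E′)))
      from-N[a] (there (there (here refl)))         = ⊥-elim (apex∉T E′ (c∈ t₂))
      from-N[a] (there (there (there (here x′≡x)))) = subst (Adj G d) x′≡x (right~apex E′)

    -- With x = apex E and y = apex F, both c and d have neighbourhood {a, b, y, x}.
    common-neighbours-twins-or-O3 : Complete G T₁ → Complete G T₂ → Triple T₁ a b c → Triple T₂ a b d →
      c ≢ d → ¬ Adj G c d → (E : Ear T₁ a c b) (F : Ear T₁ b c a) →
      Adj G d (apex E) → Adj G d (apex F) → InducedEmbedding O3 G ⊎ TwinsInK G T₁ T₂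
    common-neighbours-twins-or-O3 {T₁ = T₁} {T₂ = T₂} {a = a} {b = b}
      T₁-complete T₂-complete t₁ t₂ c≢d c≁d E F d~x d~y = by-adjacency (Adj? G (apex F) (apex E))
      where
      open TriangleEdges G T₁-complete t₁
      open TriangleEdges G T₂-complete t₂ using () renaming (a~c to a~d; b~c to b~d)

      y≢x : apex F ≢ apex E
      y≢x y≡x = apex≁opposite F (subst (λ z → Adj G z a) (sym y≡x) (Adj-sym G (left~apex E)))

      neighbours : ∀ {v} → Adj G v a → Adj G v b → Adj G v (apex F) → Adj G v (apex E) →
                   ∀ {z} → Adj G v z → z ∈ₗ a ∷ b ∷ apex F ∷ apex E ∷ []
      neighbours v~a v~b v~y v~x = maxDegree⇒listed G maxDeg
        ((a≢b t₁ ∷ ∈∧∉⇒≢ (a∈ t₁) (apex∉T F) ∷ Adj⇒≢ G (left~apex E) ∷ []) ∷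
         (Adj⇒≢ G (left~apex F) ∷ ∈∧∉⇒≢ (b∈ t₁) (apex∉T E) ∷ []) ∷ (y≢x ∷ []) ∷ [] ∷ [])
        (v~a ∷ v~b ∷ v~y ∷ v~x ∷ []) ≤-refl

      by-adjacency : Dec (Adj G (apex F) (apex E)) → InducedEmbedding O3 G ⊎ TwinsInK G T₁ T₂
      by-adjacency (yes y~x) = inj₁ (O3-embedding c≢d (∈∧∉⇒≢ (a∈ t₁) (apex∉T F)) (∈∧∉⇒≢ (b∈ t₁) (apex∉T E))
        c≁d (apex≁opposite F ∘ Adj-sym G) (apex≁opposite E ∘ Adj-sym G)
        (Adj-sym G a~c) (right~apex F) (Adj-sym G b~c) (right~apex E)
        (Adj-sym G a~d) d~y (Adj-sym G b~d) d~x
        a~b (left~apex E) (Adj-sym G (left~apex F)) y~x)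
      by-adjacency (no y≁x) = inj₂
        ( Triple-dominated t₁ (a∈ t₂) (b∈ t₂)
            (clique∋c⇒a∈⊎b∈ (neighbours (Adj-sym G a~c) (Adj-sym G b~c) (right~apex F) (right~apex E))
                            y≢x y≁x a~b a~c b~c (left~apex E) (left~apex F))
        , Triple-dominated t₂ (a∈ t₁) (b∈ t₁)
            (clique∋c⇒a∈⊎b∈ (neighbours (Adj-sym G a~d) (Adj-sym G b~d) d~y d~x)
                            y≢x y≁x a~b a~d b~d (left~apex E) (left~apex F)))

    edge-sharing-twins-or-O3 : IsInternalTriangle G T₁ → IsInternalTriangle G T₂ → T₂ ≢ T₁ →
                               ShareEdge T₁ T₂ → InducedEmbedding O3 G ⊎ TwinsInK G T₁ T₂
    edge-sharing-twins-or-O3 {T₁ = T₁} {T₂ = T₂}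
      T₁-internal@((T₁-clique@(T₁-complete , _) , ∣T₁∣≡3) , _)
      T₂-internal@(((T₂-complete , _) , ∣T₂∣≡3) , _) T₂≢T₁ shared
      with 2≤∣p∣⇒∃-distinct-pair shared
    ... | a , b , a∈T₁∩T₂ , b∈T₁∩T₂ , a≢b
      with x∈p∩q⁻ T₁ T₂ a∈T₁∩T₂ | x∈p∩q⁻ T₁ T₂ b∈T₁∩T₂
    ... | a∈T₁ , a∈T₂ | b∈T₁ , b∈T₂
      with ∣T∣≡3⇒Triple ∣T₁∣≡3 a∈T₁ b∈T₁ a≢b | ∣T∣≡3⇒Triple ∣T₂∣≡3 a∈T₂ b∈T₂ a≢b
    ... | c , t₁ | d , t₂ =
      common-neighbours-twins-or-O3 T₁-complete T₂-complete t₁ t₂ c≢d c≁d E F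
        (shared-apex T₁-complete T₂-complete t₁ t₂ c≢d c≁d E (ear T₂-internal (swap (rotate (rotate t₂)))))
        (shared-apex T₁-complete T₂-complete (swap t₁) (swap t₂) c≢d c≁d F (ear T₂-internal (rotate t₂)))
      where
      c≢d : c ≢ d
      c≢d = third-vertices-distinct T₂≢T₁ t₁ t₂
      c≁d : ¬ Adj G c d
      c≁d = third-vertices-nonadjacent T₁-clique T₂-complete t₁ t₂ c≢d
      E : Ear T₁ a c b
      E = ear T₁-internal (swap (rotate (rotate t₁)))
      F : Ear T₁ b c a
      F = ear T₁-internal (rotate t₁)

-- Part (1) holds without its hypothesis that T shares no edge with another internal triangle.
mainTheorem14 : ∀ {n} (G : Graph n) → Connected G → MaxDegreeAtMost G 4 → ¬ Isomorphic G O3 →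
    ((T : Subset n) → IsInternalTriangle G T →
    (∀ T′ → IsInternalTriangle G T′ → T′ ≢ T → ¬ ShareEdge T T′) →
    ∃ λ q → IsEar G T q × DominatedInK G T q)
    × ((T₁ T₂ : Subset n) → IsInternalTriangle G T₁ → IsInternalTriangle G T₂ → T₂ ≢ T₁ →
    ShareEdge T₁ T₂ → TwinsInK G T₁ T₂)
mainTheorem14 G connected maxDeg G≇O3 =
    (λ T T-internal _ → without-O3 (internal-triangle-dominated G maxDeg T-internal))
  , (λ T₁ T₂ T₁-internal T₂-internal T₂≢T₁ shared →
       without-O3 (edge-sharing-twins-or-O3 G maxDeg T₁-internal T₂-internal T₂≢T₁ shared))
  where
  without-O3 : ∀ {A : Set} → InducedEmbedding O3 G ⊎ A → A
  without-O3 = [ ⊥-elim ∘ G≇O3 ∘ minDegree-embedding⇒iso connected maxDeg O3-minDegree , id ]
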